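{- Let $P$ be the transition matrix of a Markov chain on a finite state space $S$, and let $k,t\in S$ be distinct states. Assume every state can reach $k$, and let $F^{k}=(I-P_{\mathcal{T}\mathcal{T}})^{ -1}$ with $\mathcal{T}=S\setminus\{k\}$ be the fundamental matrix for the absorbing set $\{k\}$ (here $t$ is transient). Then for all $s,m\in S\setminus\{t,k\}$ with $F^k_{st}>0$, \[ F_{sm}^{t,\overline{k}}=F_{mt}^k\left(\frac{F_{sm}^k}{F_{st}^k}-\frac{F_{tm}^k}{F_{tt}^k}\right). \]
   Context: For a Markov chain with transition matrix $P$ on a finite state space $S$ and a set $\mathcal{A}\subseteq S$ of states declared absorbing, with transient set $\mathcal{T}=S\setminus\mathcal{A}$ such that every transient state can reach $\mathcal{A}$, the fundamental matrix is $F^{\mathcal{A}}=(I-P_{\mathcal{T}\mathcal{T}})^{ -1}$ (indexed by $\mathcal{T}$); its entry $F^{\mathcal{A}}_{sm}$ is the expected number of visits to $m$ starting from $s$ before absorption. For $t\in\mathcal{A}$ and $i\in\mathcal{T}$, the absorption probability $Q_i^{t,\overline{\mathcal{A}\setminus\{t\}}}=(F^{\mathcal{A}}P_{\mathcal{T}\mathcal{A}})_{it}$ is the probability that the chain started at $i$ is absorbed at $t$ (before any other state of $\mathcal{A}$). The avoidance fundamental matrix for target $t$ and avoided state $k$ is defined, for transient $s,m$ with $Q_s^{t,\overline{k}}>0$, by $F_{sm}^{t,\overline{k}}=F_{sm}^{\{t,k\}}\cdot Q_m^{t,\overline{k}}/Q_s^{t,\overline{k}}$, where $F^{\{t,k\}}$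 and $Q^{t,\overline{k}}$ are computed with absorbing set $\{t,k\}$.
   Formalization: The transition matrix P has entries in ℚ, and so do the fundamental matrices $F^{k}$ and $F^{\{t,k\}}$. -}

module Defs where

open import Data.Nat using (ℕ; zero; suc)
open import Data.Fin using (Fin; zero; suc; _≟_)
open import Data.Bool using (Bool; true; false; _∨_; not; if_then_else_)
open import Data.Rational using (ℚ; 0ℚ; 1ℚ; _+_; _*_; _-_; _÷_; _<_; _≤_; ≢-nonZero)
open import Data.Rational.Properties using () renaming (_≟_ to _≟ℚ_)
open import Relation.Nullary using (yes; no)
open import Relation.Nullary.Decidable using (⌊_⌋)
open import Relation.Binary.PropositionalEquality using (_≡_)

Matrix : ℕ → Set
Matrix n = Fin n → Fin n → ℚ

Σ[_] : (n : ℕ) → (Fin n → ℚ) → ℚ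
Σ[ zero ] f = 0ℚ
Σ[ suc n ] f = f zero + Σ[ n ] (λ i → f (suc i))

δ : ∀ {n} → Fin n → Fin n → ℚ
δ i j = if ⌊ i ≟ j ⌋ then 1ℚ else 0ℚ

-- Total division with the convention x / 0 = 0 (only used at nonzero denominators).
_⊘_ : ℚ → ℚ → ℚ
p ⊘ q with q ≟ℚ 0ℚ
... | yes _ = 0ℚ
... | no q≢0 = _÷_ p q {{≢-nonZero q≢0}}

record IsStochastic {n : ℕ} (P : Matrix n) : Set where
  field
    nonneg : ∀ i j → 0ℚ ≤ P i j
    rowsum : ∀ i → Σ[ n ] (λ j → P i j) ≡ 1ℚ

data Reach {n : ℕ} (P : Matrix n) : Fin n → Fin n → Set where
  here : ∀ {i} → Reach P i i
  step : ∀ {i l j} → 0ℚ < P i l → Reach P l j → Reach P i j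

transient : ∀ {n} → (Fin n → Bool) → Fin n → ℚ
transient A i = if A i then 0ℚ else 1ℚ

-- F is the fundamental matrix (I - P_TT)^{-1} for absorbing set A:
-- on the transient block, F is a two-sided inverse of I - P_TT.
-- (Entries of F with an absorbing index are irrelevant.)
record IsFundamental {n : ℕ} (P : Matrix n) (A : Fin n → Bool) (F : Matrix n) : Set where
  field
    left  : ∀ i j → A i ≡ false → A j ≡ false →
            Σ[ n ] (λ l → transient A l * (F i l * (δ l j - P l j))) ≡ δ i j
    right : ∀ i j → A i ≡ false → A j ≡ false →
            Σ[ n ] (λ l → transient A l * ((δ i l - P i l) * F l j)) ≡ δ i j

singletonSet : ∀ {n} → Fin n → Fin n → Bool
singletonSet k i = ⌊ i ≟ k ⌋

pairSet : ∀ {n} → Fin n → Fin n → Fin n → Bool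
pairSet t k i = ⌊ i ≟ t ⌋ ∨ ⌊ i ≟ k ⌋

-- Absorption probability Q_i^{t, \bar k} = (F^{t,k} P_{T A})_{i t}, where G = F^{{t,k}}.
absorbProb : ∀ {n} → Matrix n → Matrix n → Fin n → Fin n → Fin n → ℚ
absorbProb {n} P G t k i = Σ[ n ] (λ l → transient (pairSet t k) l * (G i l * P l t))

avoidFund : ∀ {n} → Matrix n → Matrix n → Fin n → Fin n → Fin n → Fin n → ℚ
avoidFund P G t k s m = (G s m * absorbProb P G t k m) ⊘ absorbProb P G t k s

{-# OPTIONS --safe #-}
module Submission where

-- Write G for the fundamental matrix of {t,k} and Q_j for the probability of reaching t
-- before k.  Splitting the visits to c at the first passage through t gives
-- F_jc = G_jc + Q_j F_tc for c ∉ {t,k}, and F_jt = Q_j F_tt.  Algebraically this is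
-- Green's representation K_j = Σ_i G_ji ((I-P)K)_i + Σ_a Q_j^a K_a, applied to the
-- column K = F_·c, for which (I-P)K = e_c off k.  A minimum principle (every state
-- reaches k) gives F ≥ 0, hence F_tt ≥ 1 and Q_s = F_st / F_tt > 0; the formula is then
-- G_sm Q_m / Q_s rewritten with these identities.

open import Defs
open import Algebra.Bundles using (CommutativeRing)
open import Data.Bool using (Bool; true; false; _∨_; if_then_else_)
open import Data.Empty using (⊥-elim)
open import Data.Fin using (Fin; zero; suc; _≟_; punchIn)
open import Data.Fin.Properties using (punchInᵢ≢i)
open import Data.List using (allFin)
open import Data.List.Membership.Propositional.Properties using (∈-allFin)
open import Data.List.Relation.Unary.All using (lookup)
open import Data.Nat using (ℕ; zero; suc)
open import Data.Product using (_×_; _,_)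
open import Data.Rational
  using (ℚ; 0ℚ; 1ℚ; _+_; _*_; _-_; -_; _<_; _≤_; 1/_; ≢-nonZero; nonNegative; positive)
open import Data.Rational.Properties
  using (*-assoc; *-zeroˡ; *-zeroʳ; *-identityˡ; *-identityʳ; *-inverseʳ; +-identityˡ; +-identityʳ; +-inverseʳ;
         ≤-refl; ≤-trans; ≤-reflexive; ≤-antisym; <-≤-trans; <⇒≤; <⇒≢; +-mono-≤; +-monoˡ-≤;
         +-monoʳ-≤; positive⁻¹; nonNegative⁻¹; nonNeg*nonNeg⇒nonNeg; *-cancelˡ-≤-pos;
         *-cancelʳ-<-nonNeg; +-*-commutativeRing; ≤-decTotalOrder)
  renaming (_≟_ to _≟ℚ_)
open import Data.Rational.Solver using (module +-*-Solver)
open import Function using (_∘_)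
open import Relation.Binary.Bundles using (DecTotalOrder)
open import Relation.Binary.PropositionalEquality
open import Relation.Nullary using (yes; no)
open import Relation.Nullary.Decidable using (⌊_⌋; isYes≗does; dec-true; dec-false)

open import Algebra.Properties.Semiring.Sum (CommutativeRing.semiring +-*-commutativeRing)
  using (sum; sum-cong-≗; sum-remove; sum-replicate-zero; ∑-comm;
         *-distribˡ-sum; *-distribʳ-sum)
open import Data.List.Extrema (DecTotalOrder.totalOrder ≤-decTotalOrder)
  using (argmin; f[argmin]≤f[xs])
open +-*-Solver
open ≡-Reasoning

Σ≡sum : ∀ n (f : Fin n → ℚ) → Σ[ n ] f ≡ sum f
Σ≡sum zero    f = refl
Σ≡sum (suc n) f = cong (f zero +_) (Σ≡sum n (f ∘ suc))

Σ-cong : ∀ n {f g : Fin n → ℚ} → (∀ i → f i ≡ g i) → Σ[ n ] f ≡ Σ[ n ] g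
Σ-cong n {f} {g} f≗g = begin
  Σ[ n ] f  ≡⟨ Σ≡sum n f ⟩
  sum f     ≡⟨ sum-cong-≗ f≗g ⟩
  sum g     ≡⟨ Σ≡sum n g ⟨
  Σ[ n ] g  ∎

Σ-distrib-- : ∀ n (f g : Fin n → ℚ) → Σ[ n ] (λ i → f i - g i) ≡ Σ[ n ] f - Σ[ n ] g
Σ-distrib-- zero    f g = refl
Σ-distrib-- (suc n) f g =
  trans (cong (f zero - g zero +_) (Σ-distrib-- n (f ∘ suc) (g ∘ suc)))
        (solve 4 (λ a b c d → (a :- b) :+ (c :- d) := (a :+ c) :- (b :+ d)) refl
               (f zero) (g zero) (Σ[ n ] (f ∘ suc)) (Σ[ n ] (g ∘ suc)))

*-distribˡ-Σ : ∀ n c (f : Fin n → ℚ) → c * Σ[ n ] f ≡ Σ[ n ] (λ i → c * f i)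
*-distribˡ-Σ n c f = begin
  c * Σ[ n ] f             ≡⟨ cong (c *_) (Σ≡sum n f) ⟩
  c * sum f                ≡⟨ *-distribˡ-sum c f ⟩
  sum (λ i → c * f i)      ≡⟨ Σ≡sum n _ ⟨
  Σ[ n ] (λ i → c * f i)   ∎

*-distribʳ-Σ : ∀ n c (f : Fin n → ℚ) → Σ[ n ] f * c ≡ Σ[ n ] (λ i → f i * c)
*-distribʳ-Σ n c f = begin
  Σ[ n ] f * c             ≡⟨ cong (_* c) (Σ≡sum n f) ⟩
  sum f * c                ≡⟨ *-distribʳ-sum c f ⟩
  sum (λ i → f i * c)      ≡⟨ Σ≡sum n _ ⟨
  Σ[ n ] (λ i → f i * c)   ∎

Σ-comm : ∀ m n (f : Fin m → Fin n → ℚ) →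
         Σ[ m ] (λ i → Σ[ n ] (f i)) ≡ Σ[ n ] (λ j → Σ[ m ] (λ i → f i j))
Σ-comm m n f = begin
  Σ[ m ] (λ i → Σ[ n ] (f i))            ≡⟨ Σ-cong m (λ i → Σ≡sum n (f i)) ⟩
  Σ[ m ] (λ i → sum (f i))               ≡⟨ Σ≡sum m _ ⟩
  sum (λ i → sum (f i))                  ≡⟨ ∑-comm f ⟩
  sum (λ j → sum (λ i → f i j))          ≡⟨ Σ≡sum n _ ⟨
  Σ[ n ] (λ j → sum (λ i → f i j))       ≡⟨ Σ-cong n (λ j → Σ≡sum m (λ i → f i j)) ⟨
  Σ[ n ] (λ j → Σ[ m ] (λ i → f i j))    ∎

Σ-pick : ∀ n (f : Fin n → ℚ) i → (∀ l → l ≢ i → f l ≡ 0ℚ) → Σ[ n ] f ≡ f i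
Σ-pick (suc n) f i vanish = begin
  Σ[ suc n ] f                    ≡⟨ Σ≡sum (suc n) f ⟩
  sum f                           ≡⟨ sum-remove {i = i} f ⟩
  f i + sum (f ∘ punchIn i)       ≡⟨ cong (f i +_) (sum-cong-≗ (λ l → vanish _ (punchInᵢ≢i i l))) ⟩
  f i + sum {n} (λ _ → 0ℚ)        ≡⟨ cong (f i +_) (sum-replicate-zero n) ⟩
  f i + 0ℚ                        ≡⟨ +-identityʳ (f i) ⟩
  f i                             ∎

Σ-nonneg : ∀ n (f : Fin n → ℚ) → (∀ i → 0ℚ ≤ f i) → 0ℚ ≤ Σ[ n ] f
Σ-nonneg zero    f f≥0 = ≤-refl
Σ-nonneg (suc n) f f≥0 = +-mono-≤ (f≥0 zero) (Σ-nonneg n (f ∘ suc) (f≥0 ∘ suc))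

term≤Σ : ∀ n (f : Fin n → ℚ) → (∀ i → 0ℚ ≤ f i) → ∀ i → f i ≤ Σ[ n ] f
term≤Σ (suc n) f f≥0 zero =
  ≤-trans (≤-reflexive (sym (+-identityʳ (f zero))))
          (+-monoʳ-≤ (f zero) (Σ-nonneg n (f ∘ suc) (f≥0 ∘ suc)))
term≤Σ (suc n) f f≥0 (suc i) =
  ≤-trans (term≤Σ n (f ∘ suc) (f≥0 ∘ suc) i)
          (≤-trans (≤-reflexive (sym (+-identityˡ _))) (+-monoˡ-≤ _ (f≥0 zero)))

p≤q⇒p-q≤0 : ∀ {p q} → p ≤ q → p - q ≤ 0ℚ
p≤q⇒p-q≤0 {p} {q} p≤q = ≤-trans (+-monoˡ-≤ (- q) p≤q) (≤-reflexive (+-inverseʳ q))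

p≤q⇒0≤q-p : ∀ {p q} → p ≤ q → 0ℚ ≤ q - p
p≤q⇒0≤q-p {p} {q} p≤q = ≤-trans (≤-reflexive (sym (+-inverseʳ p))) (+-monoˡ-≤ (- p) p≤q)

p-q≤0⇒p≤q : ∀ {p q} → p - q ≤ 0ℚ → p ≤ q
p-q≤0⇒p≤q {p} {q} p-q≤0 =
  ≤-trans (≤-reflexive (solve 2 (λ p q → p := (p :- q) :+ q) refl p q))
          (≤-trans (+-monoˡ-≤ q p-q≤0) (≤-reflexive (+-identityˡ q)))

0≤q-p⇒p≤q : ∀ {p q} → 0ℚ ≤ q - p → p ≤ q
0≤q-p⇒p≤q {p} {q} 0≤q-p =
  ≤-trans (≤-reflexive (sym (+-identityˡ p)))
          (≤-trans (+-monoˡ-≤ p 0≤q-p) (≤-reflexive (solve 2 (λ p q → (q :- p) :+ p := q) refl p q)))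

*-nonneg : ∀ {p q} → 0ℚ ≤ p → 0ℚ ≤ q → 0ℚ ≤ p * q
*-nonneg {p} {q} 0≤p 0≤q = nonNegative⁻¹ _
  {{nonNeg*nonNeg⇒nonNeg p {{nonNegative 0≤p}} q {{nonNegative 0≤q}}}}

*≢0⇒ˡ : ∀ {p q} → p * q ≢ 0ℚ → p ≢ 0ℚ
*≢0⇒ˡ {p} {q} pq≢0 p≡0 = pq≢0 (trans (cong (_* q) p≡0) (*-zeroˡ q))

*≢0⇒ʳ : ∀ {p q} → p * q ≢ 0ℚ → q ≢ 0ℚ
*≢0⇒ʳ {p} {q} pq≢0 q≡0 = pq≢0 (trans (cong (p *_) q≡0) (*-zeroʳ p))

0<p*q⇒0<p : ∀ {p q} → 0ℚ < q → 0ℚ < p * q → 0ℚ < p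
0<p*q⇒0<p {p} {q} 0<q 0<pq = let instance _ = nonNegative (<⇒≤ 0<q) in
  *-cancelʳ-<-nonNeg q (subst (_< p * q) (sym (*-zeroˡ q)) 0<pq)

p⊘q*q≡p : ∀ {p q} → q ≢ 0ℚ → (p ⊘ q) * q ≡ p
p⊘q*q≡p {p} {q} q≢0 with q ≟ℚ 0ℚ
... | yes q≡0 = ⊥-elim (q≢0 q≡0)
... | no q≢0′ = let instance _ = ≢-nonZero q≢0′ in begin
  (p * 1/ q) * q  ≡⟨ solve 3 (λ p q q⁻¹ → (p :* q⁻¹) :* q := p :* (q :* q⁻¹)) refl p q (1/ q) ⟩
  p * (q * 1/ q)  ≡⟨ cong (p *_) (*-inverseʳ q) ⟩
  p * 1ℚ          ≡⟨ *-identityʳ p ⟩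
  p               ∎

⊘-unique : ∀ {p q r} → q ≢ 0ℚ → r * q ≡ p → p ⊘ q ≡ r
⊘-unique {p} {q} {r} q≢0 rq≡p with q ≟ℚ 0ℚ
... | yes q≡0 = ⊥-elim (q≢0 q≡0)
... | no q≢0′ = let instance _ = ≢-nonZero q≢0′ in begin
  p * 1/ q        ≡⟨ cong (_* 1/ q) rq≡p ⟨
  (r * q) * 1/ q  ≡⟨ *-assoc r q (1/ q) ⟩
  r * (q * 1/ q)  ≡⟨ cong (r *_) (*-inverseʳ q) ⟩
  r * 1ℚ          ≡⟨ *-identityʳ r ⟩
  r               ∎

≟-diag : ∀ {n} (i : Fin n) → ⌊ i ≟ i ⌋ ≡ true
≟-diag i = trans (isYes≗does (i ≟ i)) (dec-true (i ≟ i) refl)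

≟-off : ∀ {n} {i j : Fin n} → i ≢ j → ⌊ i ≟ j ⌋ ≡ false
≟-off {i = i} {j} i≢j = trans (isYes≗does (i ≟ j)) (dec-false (i ≟ j) i≢j)

δ-diag : ∀ {n} (i : Fin n) → δ i i ≡ 1ℚ
δ-diag i = cong (λ b → if b then 1ℚ else 0ℚ) (≟-diag i)

δ-off : ∀ {n} {i j : Fin n} → i ≢ j → δ i j ≡ 0ℚ
δ-off i≢j = cong (λ b → if b then 1ℚ else 0ℚ) (≟-off i≢j)

δ-nonneg : ∀ {n} (i j : Fin n) → 0ℚ ≤ δ i j
δ-nonneg i j with ⌊ i ≟ j ⌋
... | true  = <⇒≤ (positive⁻¹ 1ℚ)
... | false = ≤-refl

Σ-δˡ : ∀ n i (f : Fin n → ℚ) → Σ[ n ] (λ l → δ i l * f l) ≡ f i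
Σ-δˡ n i f = begin
  Σ[ n ] (λ l → δ i l * f l)  ≡⟨ Σ-pick n _ i (λ l l≢i → trans (cong (_* f l) (δ-off (l≢i ∘ sym))) (*-zeroˡ (f l))) ⟩
  δ i i * f i                 ≡⟨ cong (_* f i) (δ-diag i) ⟩
  1ℚ * f i                    ≡⟨ *-identityˡ (f i) ⟩
  f i                         ∎

Σ-δʳ : ∀ n c (f : Fin n → ℚ) → Σ[ n ] (λ l → f l * δ l c) ≡ f c
Σ-δʳ n c f = begin
  Σ[ n ] (λ l → f l * δ l c)  ≡⟨ Σ-pick n _ c (λ l l≢c → trans (cong (f l *_) (δ-off l≢c)) (*-zeroʳ (f l))) ⟩
  f c * δ c c                 ≡⟨ cong (f c *_) (δ-diag c) ⟩
  f c * 1ℚ                    ≡⟨ *-identityʳ (f c) ⟩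
  f c                         ∎

Σ-*-δ : ∀ n (f g : Fin n → ℚ) c → Σ[ n ] (λ i → f i * (g i * δ i c)) ≡ f c * g c
Σ-*-δ n f g c = trans (Σ-cong n (λ i → sym (*-assoc (f i) (g i) (δ i c)))) (Σ-δʳ n c (λ i → f i * g i))

_·ᵥ_ : ∀ {n} → Matrix n → (Fin n → ℚ) → Fin n → ℚ
_·ᵥ_ {n} M v i = Σ[ n ] (λ l → M i l * v l)

I-_ : ∀ {n} → Matrix n → Matrix n
(I- P) i l = δ i l - P i l

[I-P]v≡v-Pv : ∀ {n} (P : Matrix n) v i → ((I- P) ·ᵥ v) i ≡ v i - (P ·ᵥ v) i
[I-P]v≡v-Pv {n} P v i = begin
  Σ[ n ] (λ l → (δ i l - P i l) * v l)
    ≡⟨ Σ-cong n (λ l → solve 3 (λ d p x → (d :- p) :* x := d :* x :- p :* x) refl (δ i l) (P i l) (v l)) ⟩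
  Σ[ n ] (λ l → δ i l * v l - P i l * v l)
    ≡⟨ Σ-distrib-- n _ _ ⟩
  Σ[ n ] (λ l → δ i l * v l) - (P ·ᵥ v) i
    ≡⟨ cong (_- (P ·ᵥ v) i) (Σ-δˡ n i v) ⟩
  v i - (P ·ᵥ v) i ∎

absorbing : ∀ {n} → (Fin n → Bool) → Fin n → ℚ
absorbing A i = if A i then 1ℚ else 0ℚ

-- A ∪ {t}; pairSet t k is definitionally insertState t (singletonSet k).
insertState : ∀ {n} → Fin n → (Fin n → Bool) → Fin n → Bool
insertState t A i = ⌊ i ≟ t ⌋ ∨ A i

-- Column c of F, set to 0 on A, where IsFundamental leaves F unconstrained.
column : ∀ {n} → (Fin n → Bool) → Matrix n → Fin n → Fin n → ℚ
column A F c l = transient A l * F l c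

-- For a ∈ B, the probability Q_j^a of being absorbed at a; absorbProb P G t k = hittingProb P (pairSet t k) G · t.
hittingProb : ∀ {n} → Matrix n → (Fin n → Bool) → Matrix n → Fin n → Fin n → ℚ
hittingProb {n} P B G j a = Σ[ n ] (λ i → transient B i * (G j i * P i a))

module _ {n} {A : Fin n → Bool} {i : Fin n} where

  transient-false : A i ≡ false → transient A i ≡ 1ℚ
  transient-false = cong (λ b → if b then 0ℚ else 1ℚ)

  transient-true : A i ≡ true → transient A i ≡ 0ℚ
  transient-true = cong (λ b → if b then 0ℚ else 1ℚ)

  absorbing-true : A i ≡ true → absorbing A i ≡ 1ℚ
  absorbing-true = cong (λ b → if b then 1ℚ else 0ℚ)

  transient-*-cong : ∀ {x y} → (A i ≡ false → x ≡ y) → transient A i * x ≡ transient A i * y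
  transient-*-cong {x} {y} x≡y with A i
  ... | false = cong (1ℚ *_) (x≡y refl)
  ... | true  = trans (*-zeroˡ x) (sym (*-zeroˡ y))

column-transient : ∀ {n} {A : Fin n → Bool} {F i} c → A i ≡ false → column A F c i ≡ F i c
column-transient {A = A} {F} {i} c Ai = trans (cong (_* F i c) (transient-false {A = A} Ai)) (*-identityˡ (F i c))

fundamental-column : ∀ {n} {P : Matrix n} {A F} → IsFundamental P A F →
                     ∀ {i c} → A i ≡ false → A c ≡ false → ((I- P) ·ᵥ column A F c) i ≡ δ i c
fundamental-column {n} {P} {A} {F} isF {i} {c} Ai Ac =
  trans (Σ-cong n (λ l → solve 3 (λ x a f → x :* (a :* f) := a :* (x :* f)) refl
                                  ((I- P) i l) (transient A l) (F l c)))
        (IsFundamental.right isF i c Ai Ac)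

module _ {n} {P : Matrix n} (stochastic : IsStochastic P) (u : Fin n → ℚ) where
  open IsStochastic stochastic

  -- u_i ≥ Σ_l P_il u_l is an average of values ≥ μ = u_i, which forces u_l = μ wherever P_il > 0.
  minimum-spreads : ∀ {μ} → (∀ l → μ ≤ u l) → ∀ {i l} →
                    (P ·ᵥ u) i ≤ u i → u i ≡ μ → 0ℚ < P i l → u l ≡ μ
  minimum-spreads {μ} μ≤u {i} {l} Pu≤u ui≡μ 0<Pil = ≤-antisym ul≤μ (μ≤u l)
    where
    excess : Fin n → ℚ
    excess l′ = P i l′ * (u l′ - μ)

    Σexcess : Σ[ n ] excess ≡ (P ·ᵥ u) i - μ
    Σexcess = begin
      Σ[ n ] excess
        ≡⟨ Σ-cong n (λ l′ → solve 3 (λ p x m → p :* (x :- m) := p :* x :- m :* p) refl (P i l′) (u l′) μ) ⟩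
      Σ[ n ] (λ l′ → P i l′ * u l′ - μ * P i l′)
        ≡⟨ Σ-distrib-- n _ _ ⟩
      (P ·ᵥ u) i - Σ[ n ] (λ l′ → μ * P i l′)
        ≡⟨ cong (λ r → (P ·ᵥ u) i - r) (*-distribˡ-Σ n μ (P i)) ⟨
      (P ·ᵥ u) i - μ * Σ[ n ] (P i)
        ≡⟨ cong (λ r → (P ·ᵥ u) i - μ * r) (rowsum i) ⟩
      (P ·ᵥ u) i - μ * 1ℚ
        ≡⟨ cong (λ r → (P ·ᵥ u) i - r) (*-identityʳ μ) ⟩
      (P ·ᵥ u) i - μ ∎

    excessₗ≤0 : excess l ≤ 0ℚ
    excessₗ≤0 = ≤-trans (term≤Σ n excess (λ l′ → *-nonneg (nonneg i l′) (p≤q⇒0≤q-p (μ≤u l′))) l)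
                        (≤-trans (≤-reflexive Σexcess) (p≤q⇒p-q≤0 (≤-trans Pu≤u (≤-reflexive ui≡μ))))

    ul≤μ : u l ≤ μ
    ul≤μ = let instance _ = positive 0<Pil in
      p-q≤0⇒p≤q (*-cancelˡ-≤-pos (P i l) (≤-trans excessₗ≤0 (≤-reflexive (sym (*-zeroʳ (P i l))))))

  minimum-principle : ∀ {k} → (∀ i → Reach P i k) →
                      (∀ i → i ≢ k → (P ·ᵥ u) i ≤ u i) → ∀ l → u k ≤ u l
  minimum-principle {k} reach superharmonic l =
    ≤-trans (≤-reflexive (propagate (reach i₀) refl)) (μ≤u l)
    where
    i₀ : Fin n
    i₀ = argmin u k (allFin n)

    μ≤u : ∀ l → u i₀ ≤ u l
    μ≤u l = lookup (f[argmin]≤f[xs] k (allFin n)) (∈-allFin l)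

    propagate : ∀ {i} → Reach P i k → u i ≡ u i₀ → u k ≡ u i₀
    propagate here ui≡μ = ui≡μ
    propagate {i} (step 0<Pil reach-l) ui≡μ with i ≟ k
    ... | yes refl = ui≡μ
    ... | no i≢k   = propagate reach-l (minimum-spreads μ≤u (superharmonic i i≢k) ui≡μ 0<Pil)

module _ {n} {P : Matrix n} (stochastic : IsStochastic P) {k : Fin n} (reach : ∀ i → Reach P i k)
         {F : Matrix n} (isF : IsFundamental P (singletonSet k) F) {c : Fin n} (c≢k : c ≢ k) where

  private
    u : Fin n → ℚ
    u = column (singletonSet k) F c

    u-equation : ∀ {i} → i ≢ k → u i - (P ·ᵥ u) i ≡ δ i c
    u-equation {i} i≢k = trans (sym ([I-P]v≡v-Pv P u i)) (fundamental-column isF (≟-off i≢k) (≟-off c≢k))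

  fundamental-column-nonneg : ∀ l → 0ℚ ≤ column (singletonSet k) F c l
  fundamental-column-nonneg =
    subst (λ x → ∀ l → x ≤ u l) uk≡0 (minimum-principle stochastic u reach superharmonic)
    where
    uk≡0 : u k ≡ 0ℚ
    uk≡0 = trans (cong (_* F k c) (transient-true {A = singletonSet k} (≟-diag k))) (*-zeroˡ (F k c))

    superharmonic : ∀ i → i ≢ k → (P ·ᵥ u) i ≤ u i
    superharmonic i i≢k = 0≤q-p⇒p≤q (≤-trans (δ-nonneg i c) (≤-reflexive (sym (u-equation i≢k))))

  fundamental-diagonal-pos : 0ℚ < F c c
  fundamental-diagonal-pos =
    <-≤-trans (positive⁻¹ 1ℚ) (≤-trans (+-monoʳ-≤ 1ℚ 0≤Pu) (≤-reflexive 1+Pu≡Fcc))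
    where
    0≤Pu : 0ℚ ≤ (P ·ᵥ u) c
    0≤Pu = Σ-nonneg n _ (λ l → *-nonneg (IsStochastic.nonneg stochastic c l) (fundamental-column-nonneg l))

    1+Pu≡Fcc : 1ℚ + (P ·ᵥ u) c ≡ F c c
    1+Pu≡Fcc = begin
      1ℚ + (P ·ᵥ u) c                   ≡⟨ cong (_+ (P ·ᵥ u) c) (trans (sym (δ-diag c)) (sym (u-equation c≢k))) ⟩
      (u c - (P ·ᵥ u) c) + (P ·ᵥ u) c   ≡⟨ solve 2 (λ x y → (x :- y) :+ y := x) refl (u c) ((P ·ᵥ u) c) ⟩
      u c                               ≡⟨ column-transient {A = singletonSet k} {F} c (≟-off c≢k) ⟩
      F c c                             ∎

module _ {n} {P : Matrix n} {B : Fin n → Bool} {G : Matrix n} (isG : IsFundamental P B G)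
         {j : Fin n} (Bj : B j ≡ false) where

  fundamental-times-I-P : ∀ l → Σ[ n ] (λ i → transient B i * (G j i * (I- P) i l))
                                ≡ δ j l - absorbing B l * hittingProb P B G j l
  fundamental-times-I-P l with B l in Bl
  ... | false = trans (IsFundamental.left isG j l Bj Bl)
                      (solve 2 (λ d h → d := d :- con 0ℚ :* h) refl (δ j l) (hittingProb P B G j l))
  ... | true  = begin
    Σ[ n ] (λ i → tr i * (G j i * (δ i l - P i l)))
      ≡⟨ Σ-cong n (λ i → solve 4 (λ a g d p → a :* (g :* (d :- p)) := a :* (g :* d) :- a :* (g :* p)) refl
                                 (tr i) (G j i) (δ i l) (P i l)) ⟩
    Σ[ n ] (λ i → tr i * (G j i * δ i l) - tr i * (G j i * P i l))
      ≡⟨ Σ-distrib-- n _ _ ⟩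
    Σ[ n ] (λ i → tr i * (G j i * δ i l)) - hit
      ≡⟨ cong (_- hit) (Σ-*-δ n tr (G j) l) ⟩
    tr l * G j l - hit
      ≡⟨ cong (λ x → x * G j l - hit) (transient-true {A = B} Bl) ⟩
    0ℚ * G j l - hit
      ≡⟨ solve 2 (λ g h → con 0ℚ :* g :- h := con 0ℚ :- con 1ℚ :* h) refl (G j l) hit ⟩
    0ℚ - 1ℚ * hit
      ≡⟨ cong (λ x → x - 1ℚ * hit) (δ-off j≢l) ⟨
    δ j l - 1ℚ * hit ∎
    where
    tr : Fin n → ℚ
    tr = transient B
    hit : ℚ
    hit = hittingProb P B G j l
    j≢l : j ≢ l
    j≢l refl with trans (sym Bj) Bl
    ... | ()

  green-representation : (K : Fin n → ℚ) →
    K j ≡ Σ[ n ] (λ i → transient B i * (G j i * ((I- P) ·ᵥ K) i))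
          + Σ[ n ] (λ a → absorbing B a * (hittingProb P B G j a * K a))
  green-representation K = begin
    K j            ≡⟨ solve 2 (λ x y → x := (x :- y) :+ y) refl (K j) S ⟩
    (K j - S) + S  ≡⟨ cong (_+ S) R≡Kj-S ⟨
    R + S          ∎
    where
    tr : Fin n → ℚ
    tr = transient B
    hit : Fin n → ℚ
    hit = hittingProb P B G j
    S R : ℚ
    S = Σ[ n ] (λ a → absorbing B a * (hit a * K a))
    R = Σ[ n ] (λ i → tr i * (G j i * ((I- P) ·ᵥ K) i))

    expand : ∀ i → tr i * (G j i * ((I- P) ·ᵥ K) i)
                   ≡ Σ[ n ] (λ l → tr i * (G j i * (I- P) i l) * K l)
    expand i = begin
      tr i * (G j i * ((I- P) ·ᵥ K) i)
        ≡⟨ *-assoc (tr i) (G j i) _ ⟨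
      tr i * G j i * ((I- P) ·ᵥ K) i
        ≡⟨ *-distribˡ-Σ n (tr i * G j i) _ ⟩
      Σ[ n ] (λ l → tr i * G j i * ((I- P) i l * K l))
        ≡⟨ Σ-cong n (λ l → solve 4 (λ a g x y → a :* g :* (x :* y) := a :* (g :* x) :* y) refl (tr i) (G j i) ((I- P) i l) (K l)) ⟩
      Σ[ n ] (λ l → tr i * (G j i * (I- P) i l) * K l) ∎

    R≡Kj-S : R ≡ K j - S
    R≡Kj-S = begin
      R
        ≡⟨ Σ-cong n expand ⟩
      Σ[ n ] (λ i → Σ[ n ] (λ l → tr i * (G j i * (I- P) i l) * K l))
        ≡⟨ Σ-comm n n _ ⟩
      Σ[ n ] (λ l → Σ[ n ] (λ i → tr i * (G j i * (I- P) i l) * K l))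
        ≡⟨ Σ-cong n (λ l → *-distribʳ-Σ n (K l) _) ⟨
      Σ[ n ] (λ l → Σ[ n ] (λ i → tr i * (G j i * (I- P) i l)) * K l)
        ≡⟨ Σ-cong n (λ l → cong (_* K l) (fundamental-times-I-P l)) ⟩
      Σ[ n ] (λ l → (δ j l - absorbing B l * hit l) * K l)
        ≡⟨ Σ-cong n (λ l → solve 4 (λ d b h x → (d :- b :* h) :* x := d :* x :- b :* (h :* x)) refl (δ j l) (absorbing B l) (hit l) (K l)) ⟩
      Σ[ n ] (λ l → δ j l * K l - absorbing B l * (hit l * K l))
        ≡⟨ Σ-distrib-- n _ _ ⟩
      Σ[ n ] (λ l → δ j l * K l) - S
        ≡⟨ cong (_- S) (Σ-δˡ n j K) ⟩
      K j - S ∎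

insertState-target : ∀ {n} (t : Fin n) (A : Fin n → Bool) → insertState t A t ≡ true
insertState-target t A = cong (_∨ A t) (≟-diag t)

insertState-other : ∀ {n} {t a : Fin n} (A : Fin n → Bool) → a ≢ t → insertState t A a ≡ A a
insertState-other A a≢t = cong (_∨ A _) (≟-off a≢t)

insertState-false : ∀ {n} {t : Fin n} {A : Fin n → Bool} {i} → insertState t A i ≡ false → A i ≡ false
insertState-false {t = t} {i = i} Bi with ⌊ i ≟ t ⌋
... | false = Bi

absorbing*transient : ∀ {n} (A : Fin n → Bool) i → absorbing A i * transient A i ≡ 0ℚ
absorbing*transient A i with A i
... | true  = refl
... | false = refl

first-passage-decomposition :
  ∀ {n} {P : Matrix n} {A : Fin n → Bool} {F G : Matrix n} {t j c : Fin n} →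
  IsFundamental P A F → IsFundamental P (insertState t A) G →
  A t ≡ false → insertState t A j ≡ false → A c ≡ false →
  F j c ≡ transient (insertState t A) c * G j c + hittingProb P (insertState t A) G j t * F t c
first-passage-decomposition {n} {P} {A} {F} {G} {t} {j} {c} isF isG At Bj Ac = begin
  F j c
    ≡⟨ column-transient {A = A} {F} c (insertState-false {A = A} Bj) ⟨
  K j
    ≡⟨ green-representation isG Bj K ⟩
  Σ[ n ] (λ i → transient B i * (G j i * ((I- P) ·ᵥ K) i)) + Σ[ n ] (λ a → absorbing B a * (hit a * K a))
    ≡⟨ cong₂ _+_ visits absorbed ⟩
  transient B c * G j c + hit t * F t c ∎
  where
  B : Fin n → Bool
  B = insertState t A
  K hit : Fin n → ℚ
  K = column A F c
  hit = hittingProb P B G j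

  visits : Σ[ n ] (λ i → transient B i * (G j i * ((I- P) ·ᵥ K) i)) ≡ transient B c * G j c
  visits = trans (Σ-cong n (λ i → transient-*-cong {A = B} {i}
                   (λ Bi → cong (G j i *_) (fundamental-column isF (insertState-false {A = A} {i} Bi) Ac))))
                 (Σ-*-δ n (transient B) (G j) c)

  off-t : ∀ a → a ≢ t → absorbing B a * (hit a * K a) ≡ 0ℚ
  off-t a a≢t = begin
    absorbing B a * (hit a * K a)
      ≡⟨ cong (λ b → (if b then 1ℚ else 0ℚ) * (hit a * K a)) (insertState-other A a≢t) ⟩
    absorbing A a * (hit a * (transient A a * F a c))
      ≡⟨ solve 4 (λ b h x f → b :* (h :* (x :* f)) := h :* f :* (b :* x)) refl (absorbing A a) (hit a) (transient A a) (F a c) ⟩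
    hit a * F a c * (absorbing A a * transient A a)
      ≡⟨ cong (hit a * F a c *_) (absorbing*transient A a) ⟩
    hit a * F a c * 0ℚ
      ≡⟨ *-zeroʳ (hit a * F a c) ⟩
    0ℚ ∎

  absorbed : Σ[ n ] (λ a → absorbing B a * (hit a * K a)) ≡ hit t * F t c
  absorbed = begin
    Σ[ n ] (λ a → absorbing B a * (hit a * K a))
      ≡⟨ Σ-pick n _ t off-t ⟩
    absorbing B t * (hit t * K t)
      ≡⟨ cong₂ (λ b x → b * (hit t * x)) (absorbing-true {A = B} (insertState-target t A)) (column-transient {A = A} {F} c At) ⟩
    1ℚ * (hit t * F t c)
      ≡⟨ *-identityˡ _ ⟩
    hit t * F t c ∎

module _ {n} {P : Matrix n} {k t : Fin n} (t≢k : t ≢ k) {F G : Matrix n}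
         (isF : IsFundamental P (singletonSet k) F) (isG : IsFundamental P (pairSet t k) G) where

  private
    Q : Fin n → ℚ
    Q = absorbProb P G t k

    pairSet-other : ∀ {j} → j ≢ t → j ≢ k → pairSet t k j ≡ false
    pairSet-other j≢t j≢k = trans (insertState-other (singletonSet k) j≢t) (≟-off j≢k)

    decomposition : ∀ {j c} → j ≢ t → j ≢ k → c ≢ k →
                    F j c ≡ transient (pairSet t k) c * G j c + Q j * F t c
    decomposition j≢t j≢k c≢k =
      first-passage-decomposition isF isG (≟-off t≢k) (pairSet-other j≢t j≢k) (≟-off c≢k)

  visits-to-target : ∀ {j} → j ≢ t → j ≢ k → F j t ≡ Q j * F t t
  visits-to-target {j} j≢t j≢k = begin
    F j t
      ≡⟨ decomposition j≢t j≢k t≢k ⟩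
    transient (pairSet t k) t * G j t + Q j * F t t
      ≡⟨ cong (λ u → u * G j t + Q j * F t t) (transient-true {A = pairSet t k} {t} (insertState-target t (singletonSet k))) ⟩
    0ℚ * G j t + Q j * F t t
      ≡⟨ solve 2 (λ g a → con 0ℚ :* g :+ a := a) refl (G j t) (Q j * F t t) ⟩
    Q j * F t t ∎

  visits-avoiding-target : ∀ {j m} → j ≢ t → j ≢ k → m ≢ t → m ≢ k → G j m ≡ F j m - Q j * F t m
  visits-avoiding-target {j} {m} j≢t j≢k m≢t m≢k = begin
    G j m
      ≡⟨ solve 2 (λ g a → g := con 1ℚ :* g :+ a :- a) refl (G j m) (Q j * F t m) ⟩
    1ℚ * G j m + Q j * F t m - Q j * F t m
      ≡⟨ cong (λ u → u * G j m + Q j * F t m - Q j * F t m) (transient-false {A = pairSet t k} {m} (pairSet-other m≢t m≢k)) ⟨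
    transient (pairSet t k) m * G j m + Q j * F t m - Q j * F t m
      ≡⟨ cong (_- Q j * F t m) (decomposition j≢t j≢k m≢k) ⟨
    F j m - Q j * F t m ∎

  avoidFund-formula : ∀ {s m} → s ≢ t → s ≢ k → m ≢ t → m ≢ k → F s t ≢ 0ℚ →
                      avoidFund P G t k s m ≡ F m t * ((F s m ⊘ F s t) - (F t m ⊘ F t t))
  avoidFund-formula {s} {m} s≢t s≢k m≢t m≢k Fst≢0 = ⊘-unique Qs≢0 (begin
    F m t * (x - y) * Q s
      ≡⟨ cong (λ f → f * (x - y) * Q s) (visits-to-target m≢t m≢k) ⟩
    Q m * F t t * (x - y) * Q s
      ≡⟨ solve 5 (λ a b x y q → a :* b :* (x :- y) :* q := (x :* (q :* b) :- q :* (y :* b)) :* a) refl (Q m) (F t t) x y (Q s) ⟩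
    (x * (Q s * F t t) - Q s * (y * F t t)) * Q m
      ≡⟨ cong₂ (λ u v → (x * u - Q s * v) * Q m) (sym Fst≡QsFtt) (p⊘q*q≡p Ftt≢0) ⟩
    (x * F s t - Q s * F t m) * Q m
      ≡⟨ cong (λ u → (u - Q s * F t m) * Q m) (p⊘q*q≡p Fst≢0) ⟩
    (F s m - Q s * F t m) * Q m
      ≡⟨ cong (_* Q m) (visits-avoiding-target s≢t s≢k m≢t m≢k) ⟨
    G s m * Q m ∎)
    where
    x y : ℚ
    x = F s m ⊘ F s t
    y = F t m ⊘ F t t
    Fst≡QsFtt : F s t ≡ Q s * F t t
    Fst≡QsFtt = visits-to-target s≢t s≢k
    Qs≢0 : Q s ≢ 0ℚ
    Qs≢0 = *≢0⇒ˡ {q = F t t} (subst (_≢ 0ℚ) Fst≡QsFtt Fst≢0)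
    Ftt≢0 : F t t ≢ 0ℚ
    Ftt≢0 = *≢0⇒ʳ {Q s} (subst (_≢ 0ℚ) Fst≡QsFtt Fst≢0)

corollary1 : (n : ℕ) (P : Matrix n) → IsStochastic P →
    (k t : Fin n) → t ≢ k →
    (∀ i → Reach P i k) →
    (F : Matrix n) → IsFundamental P (singletonSet k) F →
    (G : Matrix n) → IsFundamental P (pairSet t k) G →
    (s m : Fin n) → s ≢ t → s ≢ k → m ≢ t → m ≢ k →
    0ℚ < F s t →
    (0ℚ < absorbProb P G t k s)
      × (avoidFund P G t k s m ≡ F m t * ((F s m ⊘ F s t) - (F t m ⊘ F t t)))
corollary1 n P stochastic k t t≢k reach F isF G isG s m s≢t s≢k m≢t m≢k 0<Fst =
  0<Qs , avoidFund-formula t≢k isF isG s≢t s≢k m≢t m≢k (<⇒≢ 0<Fst ∘ sym)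
  where
  0<Ftt : 0ℚ < F t t
  0<Ftt = fundamental-diagonal-pos stochastic reach isF t≢k

  0<Qs : 0ℚ < absorbProb P G t k s
  0<Qs = 0<p*q⇒0<p 0<Ftt (subst (0ℚ <_) (visits-to-target t≢k isF isG s≢t s≢k) 0<Fst)
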